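{- Let $D$ be a disconnected digraph and let $H$ be one of its connected components. An arrangement $\pi$ of $D$ is maximal (respectively maximum) for $D$ only if the arrangement of $H$ induced by $\pi$ (ordering $V(H)$ by increasing $\pi$-value) is maximal (respectively maximum) for $H$.
   Context: An arrangement of an $n$-vertex digraph $D$ is a bijection $\pi:V(D)\to\{1,\dots,n\}$, written $\pi=(v_1,\dots,v_n)$ when $\pi(v_i)=i$. For $1\le i\le n-1$, let $S_i=\{v_1,\dots,v_i\}$, $T_i=\{v_{i+1},\dots,v_n\}$, and let $c_i$ be the number of edges with tail in $S_i$ and head in $T_i$. The signature of $\pi$ is $s(\pi)=(c_1,\dots,c_{n-1})$. Let $\mathcal S$ be the set of signatures of all arrangements of $D$, partially ordered by $s'\le s$ iff $s'_i\le s_i$ for all $i$. An arrangement $\pi$ is maximal if $s(\pi)$ is a maximal element of $\mathcal S$, and maximum if $s(\pi)\ge s$ for every $s\in\mathcal S$. Connected means weakly connected. -}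

module Defs where

open import Data.Bool using (Bool; true; false)
open import Data.Nat using (ℕ; zero; suc; _≤_; _∸_)
open import Data.Fin using (Fin)
open import Data.Nat.ListAction using (sum)
open import Data.List using (List; []; _∷_; map; length; take; drop; filterᵇ; upTo; allFin)
open import Data.List.Relation.Binary.Permutation.Propositional using (_↭_)
open import Data.List.Relation.Binary.Pointwise using (Pointwise)
open import Data.Product using (Σ; _×_)
open import Relation.Binary.PropositionalEquality using (_≡_)
open import Function.Bundles using (_⇔_)

Digraph : ℕ → Set
Digraph n = Fin n → Fin n → Bool

data Reach {n : ℕ} (E : Digraph n) : Fin n → Fin n → Set where
  here : ∀ {u} → Reach E u u
  fwd  : ∀ {u x y} → Reach E u x → E x y ≡ true → Reach E u y
  bwd  : ∀ {u x y} → Reach E u x → E y x ≡ true → Reach E u y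

Connected : ∀ {n} → Digraph n → Set
Connected {n} E = (u v : Fin n) → Reach E u v

IsComponent : ∀ {n} → Digraph n → (Fin n → Bool) → Set
IsComponent {n} E H =
  Σ (Fin n) (λ w → H w ≡ true) ×
  ((u v : Fin n) → H u ≡ true → (H v ≡ true) ⇔ Reach E u v)

vertsOf : ∀ {n} → (Fin n → Bool) → List (Fin n)
vertsOf {n} H = filterᵇ H (allFin n)

-- An arrangement (v_1,…,v_k) is represented by the list of vertices in order.
-- c_i: number of edges with tail among the first i vertices and head among the rest.
cut : ∀ {n} → Digraph n → List (Fin n) → ℕ → ℕ
cut E L i = sum (map (λ u → length (filterᵇ (E u) (drop i L))) (take i L))

-- Signature (c_1,…,c_{k-1}).
signature : ∀ {n} → Digraph n → List (Fin n) → List ℕ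
signature E L = map (λ i → cut E L (suc i)) (upTo (length L ∸ 1))

_≤ₛ_ : List ℕ → List ℕ → Set
s ≤ₛ t = Pointwise _≤_ s t

-- L is a maximal arrangement of the subdigraph of E induced on vertex list W
-- (only edges between vertices of L are counted, as L ↭ W).
IsMaximal : ∀ {n} → Digraph n → List (Fin n) → List (Fin n) → Set
IsMaximal {n} E W L =
  L ↭ W ×
  ((L' : List (Fin n)) → L' ↭ W → signature E L ≤ₛ signature E L' → signature E L' ≡ signature E L)

IsMaximum : ∀ {n} → Digraph n → List (Fin n) → List (Fin n) → Set
IsMaximum {n} E W L =
  L ↭ W ×
  ((L' : List (Fin n)) → L' ↭ W → signature E L' ≤ₛ signature E L)

-- No edge joins a component H to the rest of D, so every cut of an arrangement L
-- splits as the cut of its restriction to H plus a contribution of the other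
-- vertices. Rearranging the H-vertices of L among their own positions (in any
-- order M) changes only the first summand, and as the prefix length i runs over
-- 0 … |L| the number of H-vertices among the first i runs over every value
-- 0 … |M|. So comparing L with its rearrangements compares, cut by cut, the
-- induced arrangement of H with all other arrangements of H.
module Submission where

open import Defs
open import Data.Bool using (Bool; true; false; not; T; if_then_else_)
open import Data.Nat using (ℕ; zero; suc; _+_; _≤_; _∸_; z≤n; s≤s; s≤s⁻¹)
open import Data.Nat.Properties
  using (≤-trans; ≤-reflexive; _≤?_; _<?_; ≮⇒≥; ≰⇒>; <⇒≤; m≤m+n; m≤n+m∸n; m+n∸m≡n;
         +-monoˡ-≤; +-cancelʳ-≡; +-cancelʳ-≤)
open import Data.Nat.ListAction using (sum)
open import Data.Nat.ListAction.Properties using (sum-++; sum-↭)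
open import Data.Fin using (Fin)
open import Data.List using (List; []; _∷_; _++_; map; length; head; take; drop; filterᵇ; upTo; allFin)
open import Data.Maybe using (fromMaybe)
open import Data.List.Properties
  using (take-all; drop-all; drop-drop; length-drop; length-++; map-++; filter-++;
         take++drop≡id; filter-accept; filter-reject)
open import Data.List.Relation.Unary.All using (All; []; _∷_)
open import Data.List.Relation.Unary.All.Properties using (all-filter; drop⁺; applyUpTo⁺₂; applyUpTo⁻)
open import Data.List.Relation.Binary.Pointwise using (Pointwise; []; _∷_; Pointwise-≡⇒≡; ≡⇒Pointwise-≡)
open import Data.List.Relation.Binary.Permutation.Propositional
  using (_↭_; ↭-refl; ↭-sym; ↭-trans; prep; module PermutationReasoning)
open import Data.List.Relation.Binary.Permutation.Propositional.Properties
  using (shift; ++⁺ʳ; ↭-length; All-resp-↭; filter-↭)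
  renaming (map⁺ to map⁺-↭)
open import Data.Product using (∃; _×_; _,_)
open import Function using (_∘_; id)
open import Function.Bundles using (Equivalence)
open import Relation.Nullary using (¬_; yes; no)
open import Relation.Nullary.Decidable.Core using (T?)
open import Relation.Binary.PropositionalEquality

module _ {A : Set} where

  filterᵇ-partition-↭ : (q : A → Bool) (xs : List A) → xs ↭ filterᵇ q xs ++ filterᵇ (not ∘ q) xs
  filterᵇ-partition-↭ q [] = ↭-refl
  filterᵇ-partition-↭ q (x ∷ xs) with q x
  ... | true  = prep x (filterᵇ-partition-↭ q xs)
  ... | false = ↭-trans (prep x (filterᵇ-partition-↭ q xs)) (↭-sym (shift x _ _))

  filterᵇ-filterᵇ-⊆ : (p q : A → Bool) → (∀ {x} → p x ≡ true → q x ≡ true) →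
                      ∀ xs → filterᵇ p (filterᵇ q xs) ≡ filterᵇ p xs
  filterᵇ-filterᵇ-⊆ p q p⇒q [] = refl
  filterᵇ-filterᵇ-⊆ p q p⇒q (x ∷ xs) with q x in qx
  ... | true with p x
  ...   | true  = cong (x ∷_) (filterᵇ-filterᵇ-⊆ p q p⇒q xs)
  ...   | false = filterᵇ-filterᵇ-⊆ p q p⇒q xs
  filterᵇ-filterᵇ-⊆ p q p⇒q (x ∷ xs) | false with p x in px
  ...   | false = filterᵇ-filterᵇ-⊆ p q p⇒q xs
  ...   | true with () ← trans (sym (p⇒q px)) qx

  length-filterᵇ-take+drop : (q : A → Bool) (i : ℕ) (xs : List A) →
    length (filterᵇ q (take i xs)) + length (filterᵇ q (drop i xs)) ≡ length (filterᵇ q xs)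
  length-filterᵇ-take+drop q i xs = begin
    length (filterᵇ q (take i xs)) + length (filterᵇ q (drop i xs))
      ≡⟨ length-++ (filterᵇ q (take i xs)) ⟨
    length (filterᵇ q (take i xs) ++ filterᵇ q (drop i xs))
      ≡⟨ cong length (filter-++ (T? ∘ q) (take i xs) (drop i xs)) ⟨
    length (filterᵇ q (take i xs ++ drop i xs))
      ≡⟨ cong (length ∘ filterᵇ q) (take++drop≡id i xs) ⟩
    length (filterᵇ q xs) ∎
    where open ≡-Reasoning

module _ {A B C : Set} {R : B → C → Set} (f : A → B) (g : A → C) where

  Pointwise-map⁺ : ∀ {xs} → All (λ x → R (f x) (g x)) xs → Pointwise R (map f xs) (map g xs)
  Pointwise-map⁺ []       = []
  Pointwise-map⁺ (r ∷ rs) = r ∷ Pointwise-map⁺ rs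

  Pointwise-map⁻ : ∀ xs → Pointwise R (map f xs) (map g xs) → All (λ x → R (f x) (g x)) xs
  Pointwise-map⁻ []       []       = []
  Pointwise-map⁻ (x ∷ xs) (r ∷ rs) = r ∷ Pointwise-map⁻ xs rs

-- replace q L M overwrites the q-entries of L, left to right, by the entries of M;
-- once M runs out the remaining q-entries are kept, so the length never changes.
module _ {A : Set} (q : A → Bool) where

  replace : List A → List A → List A
  replace []      M = []
  replace (x ∷ L) M = if q x then fromMaybe x (head M) ∷ replace L (drop 1 M) else x ∷ replace L M

  rank : List A → ℕ → ℕ
  rank L i = length (filterᵇ q (take i L))

  rank-∷ : ∀ {x} L i {b} → q x ≡ b → rank (x ∷ L) (suc i) ≡ (if b then suc (rank L i) else rank L i)
  rank-∷ {x} L i refl with q x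
  ... | true  = refl
  ... | false = refl

  rank-surjective : ∀ L {t} → t ≤ length (filterᵇ q L) → ∃ λ i → rank L i ≡ t
  rank-surjective L       {zero}  _ = 0 , refl
  rank-surjective (x ∷ L) {suc t} t≤ with q x in qx
  ... | true  with i , eq ← rank-surjective L (s≤s⁻¹ t≤) = suc i , trans (rank-∷ L i qx) (cong suc eq)
  ... | false with i , eq ← rank-surjective L t≤         = suc i , trans (rank-∷ L i qx) eq

  take-replace : ∀ i L M → take i (replace L M) ≡ replace (take i L) M
  take-replace zero    L       M = refl
  take-replace (suc i) []      M = refl
  take-replace (suc i) (x ∷ L) M with q x
  ... | true  = cong (fromMaybe x (head M) ∷_) (take-replace i L (drop 1 M))
  ... | false = cong (x ∷_) (take-replace i L M)

  drop-replace : ∀ i L M → drop i (replace L M) ≡ replace (drop i L) (drop (rank L i) M)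
  drop-replace zero    L       M = refl
  drop-replace (suc i) []      M = refl
  drop-replace (suc i) (x ∷ L) M with q x
  ... | true  = trans (drop-replace i L (drop 1 M)) (cong (replace (drop i L)) (drop-drop 1 (rank L i) M))
  ... | false = drop-replace i L M

  replace-filterᵇ : ∀ L → replace L (filterᵇ q L) ≡ L
  replace-filterᵇ []      = refl
  replace-filterᵇ (x ∷ L) with q x
  ... | true  = cong (x ∷_) (replace-filterᵇ L)
  ... | false = cong (x ∷_) (replace-filterᵇ L)

  filterᵇ-replace : ∀ L M → All (T ∘ q) M → length (filterᵇ q L) ≤ length M →
                    filterᵇ q (replace L M) ≡ take (length (filterᵇ q L)) M
  filterᵇ-replace []      M       _          _  = refl
  filterᵇ-replace (x ∷ L) M       qM         ≤M with q x in qx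
  filterᵇ-replace (x ∷ L) (y ∷ M) (qy ∷ qM) ≤M | true =
    trans (filter-accept (T? ∘ q) qy) (cong (y ∷_) (filterᵇ-replace L M qM (s≤s⁻¹ ≤M)))
  filterᵇ-replace (x ∷ L) M       qM         ≤M | false =
    trans (filter-reject (T? ∘ q) (subst T qx)) (filterᵇ-replace L M qM ≤M)

  filterᵇ-not-replace : ∀ L M → All (T ∘ q) M →
                        filterᵇ (not ∘ q) (replace L M) ≡ filterᵇ (not ∘ q) L
  filterᵇ-not-replace []      M         _         = refl
  filterᵇ-not-replace (x ∷ L) M         qM        with q x in qx
  filterᵇ-not-replace (x ∷ L) []        []        | true =
    trans (filter-reject (T? ∘ not ∘ q) (subst (T ∘ not) qx)) (filterᵇ-not-replace L [] [])
  filterᵇ-not-replace (x ∷ L) (y ∷ M)   (qy ∷ qM) | true =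
    trans (filter-reject (T? ∘ not ∘ q) (T⇒¬T-not qy)) (filterᵇ-not-replace L M qM)
    where
    T⇒¬T-not : ∀ {b} → T b → ¬ T (not b)
    T⇒¬T-not {true} _ ()
  filterᵇ-not-replace (x ∷ L) M         qM        | false =
    trans (filter-accept (T? ∘ not ∘ q) (subst (T ∘ not) (sym qx) _))
          (cong (x ∷_) (filterᵇ-not-replace L M qM))

module _ {n : ℕ} (E : Digraph n) where

  crossing : List (Fin n) → List (Fin n) → ℕ
  crossing S T = sum (map (λ u → length (filterᵇ (E u) T)) S)

  crossing-[]ʳ : ∀ S → crossing S [] ≡ 0
  crossing-[]ʳ []      = refl
  crossing-[]ʳ (_ ∷ S) = crossing-[]ʳ S

  crossing-partition : ∀ (q : Fin n → Bool) S T →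
    crossing S T ≡ crossing (filterᵇ q S) T + crossing (filterᵇ (not ∘ q) S) T
  crossing-partition q S T = begin
    sum (map c S)                                          ≡⟨ sum-↭ (map⁺-↭ c (filterᵇ-partition-↭ q S)) ⟩
    sum (map c (filterᵇ q S ++ filterᵇ (not ∘ q) S))       ≡⟨ cong sum (map-++ c (filterᵇ q S) _) ⟩
    sum (map c (filterᵇ q S) ++ map c (filterᵇ (not ∘ q) S)) ≡⟨ sum-++ (map c (filterᵇ q S)) _ ⟩
    crossing (filterᵇ q S) T + crossing (filterᵇ (not ∘ q) S) T ∎
    where
    open ≡-Reasoning
    c : Fin n → ℕ
    c u = length (filterᵇ (E u) T)

  crossing-from-closed : ∀ (q : Fin n → Bool) → (∀ {u v} → E u v ≡ true → q u ≡ true → q v ≡ true) →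
    ∀ S T → crossing (filterᵇ q S) T ≡ crossing (filterᵇ q S) (filterᵇ q T)
  crossing-from-closed q closed []      T = refl
  crossing-from-closed q closed (u ∷ S) T with q u in qu
  ... | true  = cong₂ _+_ (cong length (sym (filterᵇ-filterᵇ-⊆ (E u) q (λ e → closed e qu) T)))
                          (crossing-from-closed q closed S T)
  ... | false = crossing-from-closed q closed S T

  EdgeInvariant : (Fin n → Bool) → Set
  EdgeInvariant H = ∀ {u v} → E u v ≡ true → H u ≡ H v

  crossing-split : ∀ {H} → EdgeInvariant H → ∀ S T →
    crossing S T ≡ crossing (filterᵇ H S) (filterᵇ H T) + crossing (filterᵇ (not ∘ H) S) (filterᵇ (not ∘ H) T)
  crossing-split {H} inv S T = trans (crossing-partition H S T) (cong₂ _+_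
    (crossing-from-closed H         (λ e Hu → trans (sym (inv e)) Hu) S T)
    (crossing-from-closed (not ∘ H) (λ e Hu → trans (cong not (sym (inv e))) Hu) S T))

  cut-beyond : ∀ L i → length L ≤ i → cut E L i ≡ 0
  cut-beyond L i L≤i = trans (cong (crossing (take i L)) (drop-all i L L≤i)) (crossing-[]ʳ (take i L))

  Cutwise : (ℕ → ℕ → Set) → List (Fin n) → List (Fin n) → Set
  Cutwise R A B = ∀ i → R (cut E A i) (cut E B i)

  module _ {R : ℕ → ℕ → Set} {A B : List (Fin n)} (|A|≡|B| : length A ≡ length B) where

    private
      signature-B : signature E B ≡ map (λ i → cut E B (suc i)) (upTo (length A ∸ 1))
      signature-B = cong (λ m → map (λ i → cut E B (suc i)) (upTo (m ∸ 1))) (sym |A|≡|B|)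

    cutwise⇒signature : Cutwise R A B → Pointwise R (signature E A) (signature E B)
    cutwise⇒signature RAB = subst (Pointwise R (signature E A)) (sym signature-B)
      (Pointwise-map⁺ _ _ (applyUpTo⁺₂ id (length A ∸ 1) (λ i → RAB (suc i))))

    -- Cuts at 0 and at or beyond the length are 0; the signature records the others.
    signature⇒cutwise : R 0 0 → Pointwise R (signature E A) (signature E B) → Cutwise R A B
    signature⇒cutwise R00 RAB zero = R00
    signature⇒cutwise R00 RAB (suc i) with i <? length A ∸ 1
    ... | yes i< = applyUpTo⁻ id (length A ∸ 1)
                     (Pointwise-map⁻ _ _ (upTo _) (subst (Pointwise R (signature E A)) signature-B RAB)) i<
    ... | no  i≮ = subst₂ R (sym (cut-beyond A (suc i) |A|≤))
                            (sym (cut-beyond B (suc i) (subst (_≤ suc i) |A|≡|B| |A|≤))) R00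
      where
      |A|≤ : length A ≤ suc i
      |A|≤ = ≤-trans (m≤n+m∸n (length A) 1) (s≤s (≮⇒≥ i≮))

  cutwise-from-rank : ∀ {R : ℕ → ℕ → Set} (q : Fin n → Bool) L {A B} → R 0 0 →
    length A ≡ length (filterᵇ q L) → length B ≡ length (filterᵇ q L) →
    (∀ i → R (cut E A (rank q L i)) (cut E B (rank q L i))) → Cutwise R A B
  cutwise-from-rank {R} q L {A} {B} R00 |A| |B| R-at-rank t with t ≤? length (filterᵇ q L)
  ... | yes t≤ with i , refl ← rank-surjective q L t≤ = R-at-rank i
  ... | no  t≰ = subst₂ R (sym (cut-beyond A t (beyond |A|))) (sym (cut-beyond B t (beyond |B|))) R00
    where
    beyond : ∀ {m} → m ≡ length (filterᵇ q L) → m ≤ t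
    beyond refl = <⇒≤ (≰⇒> t≰)

module _ {n : ℕ} (E : Digraph n) {H : Fin n → Bool} (inv : EdgeInvariant E H) where

  outsideCut : List (Fin n) → ℕ → ℕ
  outsideCut L i = crossing E (filterᵇ (not ∘ H) (take i L)) (filterᵇ (not ∘ H) (drop i L))

  cut-replace : ∀ L M → All (T ∘ H) M → length M ≡ length (filterᵇ H L) → ∀ i →
    cut E (replace H L M) i ≡ cut E M (rank H L i) + outsideCut L i
  cut-replace L M HM |M| i = begin
    crossing E (take i L′) (drop i L′)
      ≡⟨ crossing-split E inv (take i L′) (drop i L′) ⟩
    crossing E (filterᵇ H (take i L′)) (filterᵇ H (drop i L′))
      + crossing E (filterᵇ (not ∘ H) (take i L′)) (filterᵇ (not ∘ H) (drop i L′))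
      ≡⟨ cong₂ _+_ (cong₂ (crossing E) H-prefix H-suffix)
                   (cong₂ (crossing E) outside-prefix outside-suffix) ⟩
    cut E M r + outsideCut L i ∎
    where
    open ≡-Reasoning
    L′ = replace H L M
    r  = rank H L i
    s  = length (filterᵇ H (drop i L))

    |M|≡r+s : length M ≡ r + s
    |M|≡r+s = trans |M| (sym (length-filterᵇ-take+drop H i L))

    |drop-r-M| : length (drop r M) ≡ s
    |drop-r-M| = trans (length-drop r M) (trans (cong (_∸ r) |M|≡r+s) (m+n∸m≡n r s))

    H-prefix : filterᵇ H (take i L′) ≡ take r M
    H-prefix = trans (cong (filterᵇ H) (take-replace H i L M))
      (filterᵇ-replace H (take i L) M HM (subst (r ≤_) (sym |M|≡r+s) (m≤m+n r s)))

    H-suffix : filterᵇ H (drop i L′) ≡ drop r M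
    H-suffix = begin
      filterᵇ H (drop i L′)                          ≡⟨ cong (filterᵇ H) (drop-replace H i L M) ⟩
      filterᵇ H (replace H (drop i L) (drop r M))    ≡⟨ filterᵇ-replace H (drop i L) (drop r M) (drop⁺ r HM)
                                                          (≤-reflexive (sym |drop-r-M|)) ⟩
      take s (drop r M)                              ≡⟨ take-all s (drop r M) (≤-reflexive |drop-r-M|) ⟩
      drop r M ∎

    outside-prefix : filterᵇ (not ∘ H) (take i L′) ≡ filterᵇ (not ∘ H) (take i L)
    outside-prefix = trans (cong (filterᵇ (not ∘ H)) (take-replace H i L M))
                        (filterᵇ-not-replace H (take i L) M HM)

    outside-suffix : filterᵇ (not ∘ H) (drop i L′) ≡ filterᵇ (not ∘ H) (drop i L)
    outside-suffix = trans (cong (filterᵇ (not ∘ H)) (drop-replace H i L M))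
                        (filterᵇ-not-replace H (drop i L) (drop r M) (drop⁺ r HM))

  cut-induced : ∀ L i → cut E L i ≡ cut E (filterᵇ H L) (rank H L i) + outsideCut L i
  cut-induced L i = trans (cong (λ L′ → cut E L′ i) (sym (replace-filterᵇ H L)))
                          (cut-replace L (filterᵇ H L) (all-filter (T? ∘ H) L) refl i)

  replace-↭ : ∀ L {M} → M ↭ filterᵇ H L → replace H L M ↭ L
  replace-↭ L {M} M↭ = begin
    replace H L M                                                   ↭⟨ filterᵇ-partition-↭ H (replace H L M) ⟩
    filterᵇ H (replace H L M) ++ filterᵇ (not ∘ H) (replace H L M) ≡⟨ cong₂ _++_ H-part outside-part ⟩
    M ++ filterᵇ (not ∘ H) L                                        ↭⟨ ++⁺ʳ _ M↭ ⟩
    filterᵇ H L ++ filterᵇ (not ∘ H) L                              ↭⟨ filterᵇ-partition-↭ H L ⟨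
    L ∎
    where
    open PermutationReasoning
    HM : All (T ∘ H) M
    HM = All-resp-↭ (↭-sym M↭) (all-filter (T? ∘ H) L)
    |M| : length M ≡ length (filterᵇ H L)
    |M| = ↭-length M↭
    H-part : filterᵇ H (replace H L M) ≡ M
    H-part = trans (filterᵇ-replace H L M HM (≤-reflexive (sym |M|))) (take-all _ M (≤-reflexive |M|))
    outside-part : filterᵇ (not ∘ H) (replace H L M) ≡ filterᵇ (not ∘ H) L
    outside-part = filterᵇ-not-replace H L M HM

  module Rearrangement {W L : List (Fin n)} (L↭W : L ↭ W) {M : List (Fin n)} (M↭ : M ↭ filterᵇ H W) where

    M↭L|H : M ↭ filterᵇ H L
    M↭L|H = ↭-trans M↭ (↭-sym (filter-↭ (T? ∘ H) L↭W))

    |M|≡|L|H| : length M ≡ length (filterᵇ H L)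
    |M|≡|L|H| = ↭-length M↭L|H

    L′ : List (Fin n)
    L′ = replace H L M

    L′↭W : L′ ↭ W
    L′↭W = ↭-trans (replace-↭ L M↭L|H) L↭W

    |L|≡|L′| : length L ≡ length L′
    |L|≡|L′| = ↭-length (↭-sym (replace-↭ L M↭L|H))

    cut-L′ : ∀ i → cut E L′ i ≡ cut E M (rank H L i) + outsideCut L i
    cut-L′ = cut-replace L M (All-resp-↭ (↭-sym M↭L|H) (all-filter (T? ∘ H) L)) |M|≡|L|H|

    extend : Cutwise E _≤_ (filterᵇ H L) M → Cutwise E _≤_ L L′
    extend L|H≤M i = subst₂ _≤_ (sym (cut-induced L i)) (sym (cut-L′ i))
                              (+-monoˡ-≤ (outsideCut L i) (L|H≤M (rank H L i)))

    restrict : ∀ {R : ℕ → ℕ → Set} → R 0 0 → (∀ c a b → R (a + c) (b + c) → R a b) →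
               Cutwise E R L′ L → Cutwise E R M (filterᵇ H L)
    restrict {R} R00 cancel L′RL = cutwise-from-rank E {R} H L {M} R00 |M|≡|L|H| refl
      (λ i → cancel (outsideCut L i) _ _ (subst₂ R (cut-L′ i) (cut-induced L i) (L′RL i)))

  induced-maximal : ∀ {W L} → IsMaximal E W L → IsMaximal E (filterᵇ H W) (filterᵇ H L)
  induced-maximal {W} {L} (L↭W , maximal) = filter-↭ (T? ∘ H) L↭W , no-improvement
    where
    no-improvement : ∀ M → M ↭ filterᵇ H W → signature E (filterᵇ H L) ≤ₛ signature E M →
                     signature E M ≡ signature E (filterᵇ H L)
    no-improvement M M↭ L|H≤M = Pointwise-≡⇒≡ (cutwise⇒signature E |M|≡|L|H| M≡L|H)
      where
      open Rearrangement L↭W M↭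
      L≤L′ : Cutwise E _≤_ L L′
      L≤L′ = extend (signature⇒cutwise E (sym |M|≡|L|H|) z≤n L|H≤M)
      L′≡L : Cutwise E _≡_ L′ L
      L′≡L = signature⇒cutwise E (sym |L|≡|L′|) refl
               (≡⇒Pointwise-≡ (maximal L′ L′↭W (cutwise⇒signature E |L|≡|L′| L≤L′)))
      M≡L|H : Cutwise E _≡_ M (filterᵇ H L)
      M≡L|H = restrict refl +-cancelʳ-≡ L′≡L

  induced-maximum : ∀ {W L} → IsMaximum E W L → IsMaximum E (filterᵇ H W) (filterᵇ H L)
  induced-maximum {W} {L} (L↭W , maximum) = filter-↭ (T? ∘ H) L↭W , dominated
    where
    dominated : ∀ M → M ↭ filterᵇ H W → signature E M ≤ₛ signature E (filterᵇ H L)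
    dominated M M↭ = cutwise⇒signature E |M|≡|L|H|
      (restrict z≤n +-cancelʳ-≤ (signature⇒cutwise E (sym |L|≡|L′|) z≤n (maximum L′ L′↭W)))
      where open Rearrangement L↭W M↭

component-edgeInvariant : ∀ {n} {E : Digraph n} {H} → IsComponent E H → EdgeInvariant E H
component-edgeInvariant {H = H} (_ , component) {u} {v} e with H u in Hu | H v in Hv
... | true  | true  = refl
... | false | false = refl
... | true  | false = trans (sym (Equivalence.from (component u v Hu) (fwd here e))) Hv
... | false | true  = trans (sym Hu) (Equivalence.from (component v u Hv) (bwd here e))

mainTheorem9 : {n : ℕ} (E : Digraph n) → ¬ Connected E →
    (H : Fin n → Bool) → IsComponent E H → (L : List (Fin n)) →
    (IsMaximal E (allFin n) L → IsMaximal E (vertsOf H) (filterᵇ H L)) ×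
    (IsMaximum E (allFin n) L → IsMaximum E (vertsOf H) (filterᵇ H L))
mainTheorem9 E _ H component L = induced-maximal E inv , induced-maximum E inv
  where
  inv : EdgeInvariant E H
  inv = component-edgeInvariant component
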